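{- Let $M$ be an LP$^{\text{MLN}}$ program and $U$ a set of literals with $lit(\overline{M})\subseteq U$. Suppose $T^{k+1}(M,U)$ is a flattening extension constructed from the flattening extension $T^k(M,U)$ by adding $R(X\cap U,U-X,a_{k+1})$, where $X\in PSM(T^k(M,U))$. Then: (1) $SM(T^0(M,U))=2^{U^+}$; (2) $SM(T^{k+1}(M,U)) = SM(T^k(M,U))\cup\{Y\cup\{a_{k+1}\}\mid Y\in SM(T^k(M,U)),\ Y\cap U=X\cap U\}$; (3) for every $Y\in SM(T^k(M,U))$, $W(T^{k+1}(M,U),Y)=W(T^k(M,U),Y)\cdot e^{2\alpha}$ if $Y\cap U\neq X\cap U$, and $W(T^{k+1}(M,U),Y)=W(T^k(M,U),Y)\cdot e^{\alpha}$ otherwise; and for any two stable models $Y,Z$ of $T^k(M,U)$ with $Y\cap U=Z\cap U$, $W(T^k(M,U),Y)=W(T^k(M,U),Z)$.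
   Context: A literal is an atom or its classical negation; a set of literals is consistent if it does not contain an atom together with its negation. A ground ASP rule $r$ has the form $l_1\vee\dots\vee l_k\leftarrow l_{k+1},\dots,l_m,\ not\ l_{m+1},\dots,not\ l_n$; $h(r)=\{l_1,\dots,l_k\}$, $b^+(r)=\{l_{k+1},\dots,l_m\}$, $b^-(r)=\{l_{m+1},\dots,l_n\}$; $lit(r)=h(r)\cup b^+(r)\cup b^-(r)$ and $lit(\Pi)=\bigcup_{r\in\Pi}lit(r)$. A consistent set $X$ satisfies $r$ if $b^+(r)\subseteq X$ and $b^-(r)\cap X=\emptyset$ imply $h(r)\cap X\neq\emptyset$. The GL-reduct of an ASP program $P$ w.r.t. $X$ is $P^X=\{h(r)\leftarrow b^+(r)\mid r\in P,\ b^-(r)\cap X=\emptyset\}$; $X$ is a stable model of $P$ if $X$ is consistent, satisfies $P^X$, and no proper subset of $X$ satisfies $P^X$. An LP$^{\text{MLN}}$ program is a finite set of ground weighted rules $w:r$, with $w$ a real number or the symbol $\alpha$ (infinite weight). For a program $M$: $\overline{M}=\{r\mid w:r\in M\}$; $W(M)=\exp(\sum_{w:r\in M}w)$ (a formal expression in $\alpha$); $M_X=\{w:r\in M\mid X\text{ satisfies }r\}$; $X$ is a stable model of $M$ if $X$ is a stable model of $\overline{M_X}$; $SM(M)$ is the set of stable models; $W(M,X)=W(M_X)$; $P(M,X)=\lim_{\alpha\to\infty}W(M,X)/\sum_{X'\in SM(M)}W(M,X')$; $PSM(M)=\{X\in SM(M)\mid P(M,X)\neq 0\}$ (probabilistic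 stable models). For a set $U$ of literals, $2^{U^+}$ is the set of consistent subsets of $U$. For consistent sets $X,Y$ of literals and an atom $a\notin X\cup Y$, $R(X,Y,a)$ is the LP$^{\text{MLN}}$ program consisting of the two rules $\alpha:\ \leftarrow X,\ not\ Y,\ a.$ and $\alpha:\ a\leftarrow X,\ not\ Y.$ (where "$X$" in a body means all literals of $X$ in the positive body and "$not\ Y$" means all literals of $Y$ in the negative body). A flattening extension of $M$ w.r.t. $U$ (with $lit(\overline{M})\subseteq U$) is defined by: $T^0(M,U)=M\cup\{\alpha: b.\mid b\in U\}$; $T^{i+1}(M,U)=T^i(M,U)\cup R(X\cap U,U-X,a_{i+1})$, where $X\in PSM(T^i(M,U))$ and $a_{i+1}$ is an atom not in $lit(\overline{T^i(M,U)})$. -}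

module Defs where

open import Level using (Level; _⊔_)
open import Data.Nat using (ℕ; suc; _+_; _≤_)
import Data.Nat.Properties as ℕP
open import Data.List using (List; []; _∷_; _++_; map; filter; concatMap)
open import Data.List.Membership.DecPropositional using ()
open import Data.List.Membership.Propositional using (_∈_; _∉_)
open import Data.List.Relation.Unary.All using (All; all?)
open import Data.List.Relation.Unary.Any using (Any; any?)
open import Data.Product using (_×_; _,_; proj₁; proj₂)
open import Data.Empty using (⊥)
open import Relation.Nullary using (¬_; Dec; yes; no)
open import Relation.Nullary.Decidable using (_→-dec_; ¬?)
open import Relation.Binary.PropositionalEquality using (_≡_; refl; cong)
open import Relation.Binary.Definitions using (DecidableEquality)
open import Algebra.Bundles using (CommutativeMonoid)

Atom : Set
Atom = ℕ

data Literal : Set where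
  pos : Atom → Literal
  neg : Atom → Literal   -- its classical negation ¬a

pos-inj : ∀ {m n} → pos m ≡ pos n → m ≡ n
pos-inj refl = refl

neg-inj : ∀ {m n} → neg m ≡ neg n → m ≡ n
neg-inj refl = refl

_≟L_ : DecidableEquality Literal
pos m ≟L pos n with m ℕP.≟ n
... | yes refl = yes refl
... | no m≢n = no (λ e → m≢n (pos-inj e))
neg m ≟L neg n with m ℕP.≟ n
... | yes refl = yes refl
... | no m≢n = no (λ e → m≢n (neg-inj e))
pos m ≟L neg n = no (λ ())
neg m ≟L pos n = no (λ ())

_∈?_ : (l : Literal) (X : List Literal) → Dec (l ∈ X)
l ∈? X = any? (l ≟L_) X

-- (finite) sets of literals are lists; equality of sets is mutual inclusion
LitSet : Set
LitSet = List Literal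

_⊆_ : LitSet → LitSet → Set
X ⊆ Y = ∀ {l} → l ∈ X → l ∈ Y

_≐_ : LitSet → LitSet → Set
X ≐ Y = X ⊆ Y × Y ⊆ X

_∩_ : LitSet → LitSet → LitSet
X ∩ U = filter (_∈? X) U

_−_ : LitSet → LitSet → LitSet
U − X = filter (λ l → ¬? (l ∈? X)) U

Consistent : LitSet → Set
Consistent X = ∀ a → pos a ∈ X → neg a ∈ X → ⊥

-- Ground ASP rules  h(r) ← b⁺(r), not b⁻(r)

record Rule : Set where
  constructor rule
  field
    head  : List Literal
    body⁺ : List Literal
    body⁻ : List Literal
open Rule public

litR : Rule → LitSet
litR r = head r ++ body⁺ r ++ body⁻ r

ASP : Set
ASP = List Rule

litP : ASP → LitSet
litP = concatMap litR

Satisfies : LitSet → Rule → Set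
Satisfies X r = All (_∈ X) (body⁺ r) → All (_∉ X) (body⁻ r) → Any (_∈ X) (head r)

satisfies? : ∀ X r → Dec (Satisfies X r)
satisfies? X r = all? (_∈? X) (body⁺ r) →-dec
                 (all? (λ l → ¬? (l ∈? X)) (body⁻ r) →-dec any? (_∈? X) (head r))

SatisfiesP : LitSet → ASP → Set
SatisfiesP X P = All (Satisfies X) P

reduct : ASP → LitSet → ASP
reduct P X = map (λ r → rule (head r) (body⁺ r) [])
                 (filter (λ r → all? (λ l → ¬? (l ∈? X)) (body⁻ r)) P)

StableModel : ASP → LitSet → Set
StableModel P X =
  Consistent X × SatisfiesP X (reduct P X) ×
  (∀ Y → Y ⊆ X → ¬ (X ⊆ Y) → ¬ SatisfiesP Y (reduct P X))

-- LP^MLN programs, with weights taken from a commutative monoid (G,∙,ε)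
-- (the paper uses the reals under +).  W(M) = exp(Σ w) is represented by its
-- exponent  nα + s  as the pair (n , s).

module LPMLN {c ℓ : Level} (G : CommutativeMonoid c ℓ) where
  open CommutativeMonoid G renaming (Carrier to R)

  data Weight : Set c where
    α    : Weight           -- infinite (hard) weight
    real : R → Weight

  WRule : Set c
  WRule = Weight × Rule

  Program : Set c
  Program = List WRule

  bar : Program → ASP
  bar = map proj₂

  sat : Program → LitSet → Program
  sat M X = filter (λ wr → satisfies? X (proj₂ wr)) M

  SM : Program → LitSet → Set
  SM M X = StableModel (bar (sat M X)) X

  record Exp : Set c where
    constructor _α+_
    field
      nα : ℕ
      sr : R
  open Exp public

  _≋_ : Exp → Exp → Set ℓ
  e ≋ f = Lift′ (nα e ≡ nα f) × (sr e ≈ sr f)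
    where
      Lift′ : Set → Set ℓ
      Lift′ A = Level.Lift ℓ A

  Wprog : Program → Exp
  Wprog [] = 0 α+ ε
  Wprog ((α , _) ∷ M) = suc (nα (Wprog M)) α+ sr (Wprog M)
  Wprog ((real w , _) ∷ M) = nα (Wprog M) α+ (w ∙ sr (Wprog M))

  W : Program → LitSet → Exp
  W M X = Wprog (sat M X)

  _·eα^_ : Exp → ℕ → Exp
  e ·eα^ k = (nα e + k) α+ sr e

  -- PSM(M): stable models X with P(M,X) ≠ 0.  Since all real weights are
  -- finite, lim_{α→∞} W(M,X)/Σ_{X'} W(M,X') ≠ 0 holds exactly when the
  -- coefficient of α in W(M,X) is maximal among stable models.
  PSM : Program → LitSet → Set
  PSM M X = SM M X × (∀ Y → SM M Y → nα (W M Y) ≤ nα (W M X))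

  FreshAtom : Atom → Program → Set
  FreshAtom a M = pos a ∉ litP (bar M) × neg a ∉ litP (bar M)

  Rprog : LitSet → LitSet → Atom → Program
  Rprog X Y a = (α , rule [] (X ++ pos a ∷ []) Y)
              ∷ (α , rule (pos a ∷ []) X Y)
              ∷ []

  T0 : Program → LitSet → Program
  T0 M U = M ++ map (λ b → α , rule (b ∷ []) [] []) U

  extend : LitSet → Program → LitSet → Atom → Program
  extend U T X a = T ++ Rprog (X ∩ U) (U − X) a

  data FlatExt (M : Program) (U : LitSet) : Program → Set c where
    base : FlatExt M U (T0 M U)
    step : ∀ {T} X a → FlatExt M U T → PSM T X → FreshAtom a T →
           FlatExt M U (extend U T X a)

{-# OPTIONS --safe #-}
module Submission where

-- Satisfaction of a rule only depends on the literals occurring in it, and a stable model only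
-- contains literals of its program. As a is fresh, a stable model of T ∪ R(X ∩ U, U − X, a) is
-- therefore either a stable model of T, or Z ∪ {a} for a stable model Z of T; in the latter case
-- Z agrees with X on U, because the only rule that can support a is  a ← X ∩ U, not U − X.
-- A set agreeing with X on U satisfies exactly one of the two new hard rules and any other set
-- satisfies both, whence the factors e^α and e^{2α}. These factors only depend on the trace on
-- U, so by induction along the flattening, stable models with the same trace on U have the same
-- weight; for T⁰ such models even agree on all of lit(T⁰) ⊆ U.

open import Defs
open import Data.Product using (_×_; ∃)
open import Data.Sum using (_⊎_)
open import Data.List using (List; _∷_)
open import Relation.Nullary using (¬_)
open import Function.Bundles using (_⇔_)
open import Algebra.Bundles using (CommutativeMonoid)

open import Level using (lift)
open import Data.Nat using (suc)
open import Data.Empty using (⊥-elim)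
open import Data.Product using (_,_; proj₁; proj₂)
open import Data.Sum using (inj₁; inj₂)
open import Data.List using ([]; _++_; filter; length)
open import Data.List.Properties using (filter-accept; filter-reject; filter-++)
open import Data.List.Relation.Unary.All as All using (All; []; _∷_; all?)
open import Data.List.Relation.Unary.All.Properties using (++⁺; ++⁻; filter⁺)
open import Data.List.Relation.Unary.Any using (Any; here; there)
open import Data.List.Relation.Unary.Any.Properties using (singleton⁻)
open import Data.List.Membership.Propositional using (_∈_; _∉_; find; lose)
open import Data.List.Membership.Propositional.Properties
  using (∈-filter⁺; ∈-filter⁻; ∈-map⁺; ∈-map⁻; ∈-++⁺ʳ; ∈-++⁻; ∈-concatMap⁺; ∈-concatMap⁻)
open import Data.List.Relation.Binary.Subset.Propositional.Properties
  using (⊆-refl; ⊆-trans; ∈-∷⁺ʳ; xs⊆xs++ys; map⁺; concatMap⁺; filter-⊆)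
open import Data.List.Relation.Binary.Subset.DecPropositional _≟L_ using (_⊆?_)
open import Function.Base using (_∘_)
open import Function.Bundles using (mk⇔; Equivalence)
open import Relation.Nullary using (Dec; yes; no)
open import Relation.Nullary.Decidable using (¬?; _×-dec_; decidable-stable)
import Relation.Nullary.Decidable as Dec
open import Relation.Unary using (Decidable)
open import Relation.Binary.PropositionalEquality
  using (_≡_; _≢_; refl; sym; trans; cong; subst; module ≡-Reasoning)

open Equivalence using (to; from)

All-map-∈ : ∀ {a p q} {A : Set a} {P : A → Set p} {Q : A → Set q} {xs : List A} →
            (∀ {x} → x ∈ xs → P x → Q x) → All P xs → All Q xs
All-map-∈ f ps = All.tabulate (λ x∈xs → f x∈xs (All.lookup ps x∈xs))

Any-map-∈ : ∀ {a p q} {A : Set a} {P : A → Set p} {Q : A → Set q} {xs : List A} →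
            (∀ {x} → x ∈ xs → P x → Q x) → Any P xs → Any Q xs
Any-map-∈ f ps = let _ , x∈xs , px = find ps in lose x∈xs (f x∈xs px)

filter-cong-∈ : ∀ {a p q} {A : Set a} {P : A → Set p} {Q : A → Set q}
                (P? : Decidable P) (Q? : Decidable Q) (xs : List A) →
                (∀ {x} → x ∈ xs → (P x → Q x) × (Q x → P x)) →
                filter P? xs ≡ filter Q? xs
filter-cong-∈ P? Q? [] _ = refl
filter-cong-∈ P? Q? (x ∷ xs) P⇔Q with filter-cong-∈ P? Q? xs (P⇔Q ∘ there) | P? x
... | ih | yes px = trans (cong (x ∷_) ih) (sym (filter-accept Q? (proj₁ (P⇔Q (here refl)) px)))
... | ih | no ¬px = trans ih (sym (filter-reject Q? (¬px ∘ proj₂ (P⇔Q (here refl)))))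

≐-sym : ∀ {A B} → A ≐ B → B ≐ A
≐-sym (A⊆B , B⊆A) = B⊆A , A⊆B

AgreeOn : LitSet → LitSet → LitSet → Set
AgreeOn S A B = ∀ {l} → l ∈ S → (l ∈ A → l ∈ B) × (l ∈ B → l ∈ A)

agree-refl : ∀ {S A} → AgreeOn S A A
agree-refl _ = (λ l∈A → l∈A) , (λ l∈A → l∈A)

agree-sym : ∀ {S A B} → AgreeOn S A B → AgreeOn S B A
agree-sym A~B l∈S = proj₂ (A~B l∈S) , proj₁ (A~B l∈S)

agree-trans : ∀ {S A B C} → AgreeOn S A B → AgreeOn S B C → AgreeOn S A C
agree-trans A~B B~C l∈S =
  proj₁ (B~C l∈S) ∘ proj₁ (A~B l∈S) , proj₂ (A~B l∈S) ∘ proj₂ (B~C l∈S)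

agree-mono : ∀ {S S′ A B} → S′ ⊆ S → AgreeOn S A B → AgreeOn S′ A B
agree-mono S′⊆S A~B = A~B ∘ S′⊆S

≐⇒agree : ∀ {S A B} → A ≐ B → AgreeOn S A B
≐⇒agree (A⊆B , B⊆A) _ = A⊆B , B⊆A

agree-≐∷ : ∀ {S A B l} → l ∉ S → A ≐ (l ∷ B) → AgreeOn S A B
agree-≐∷ {B = B} {l} l∉S (A⊆l∷B , l∷B⊆A) {m} m∈S =
  drop-l ∘ A⊆l∷B , l∷B⊆A ∘ there
  where
  drop-l : m ∈ l ∷ B → m ∈ B
  drop-l (here refl) = ⊥-elim (l∉S m∈S)
  drop-l (there m∈B) = m∈B

agree-∷ : ∀ {S A l} → l ∉ S → AgreeOn S (l ∷ A) A
agree-∷ l∉S = agree-≐∷ l∉S (⊆-refl , ⊆-refl)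

delete : Literal → LitSet → LitSet
delete l = filter (λ m → ¬? (m ≟L l))

∈-delete⁺ : ∀ {l m A} → m ∈ A → m ≢ l → m ∈ delete l A
∈-delete⁺ {l} = ∈-filter⁺ (λ m → ¬? (m ≟L l))

∈-delete⁻ : ∀ {l m} A → m ∈ delete l A → m ∈ A × m ≢ l
∈-delete⁻ {l} A = ∈-filter⁻ (λ m → ¬? (m ≟L l)) {xs = A}

delete-⊆ : ∀ {l A} → delete l A ⊆ A
delete-⊆ {l} {A} = filter-⊆ (λ m → ¬? (m ≟L l)) A

delete-⊆-∷ : ∀ {l A B} → A ⊆ (l ∷ B) → delete l A ⊆ B
delete-⊆-∷ {A = A} A⊆l∷B m∈ with ∈-delete⁻ A m∈
... | m∈A , m≢l with A⊆l∷B m∈A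
...   | here m≡l = ⊥-elim (m≢l m≡l)
...   | there m∈B = m∈B

∷-delete-≐ : ∀ {l A} → l ∈ A → A ≐ (l ∷ delete l A)
∷-delete-≐ {l} {A} l∈A = split , ∈-∷⁺ʳ l∈A delete-⊆
  where
  split : A ⊆ (l ∷ delete l A)
  split {m} m∈A with m ≟L l
  ... | yes m≡l = here m≡l
  ... | no m≢l = there (∈-delete⁺ m∈A m≢l)

agree-delete : ∀ {S A l} → l ∉ S → AgreeOn S A (delete l A)
agree-delete l∉S m∈S =
  (λ m∈A → ∈-delete⁺ m∈A (λ { refl → l∉S m∈S })) , delete-⊆

∈-∩⁺ : ∀ A U {l} → l ∈ U → l ∈ A → l ∈ A ∩ U
∈-∩⁺ A U = ∈-filter⁺ (_∈? A)

∈-∩⁻ : ∀ A U {l} → l ∈ A ∩ U → l ∈ U × l ∈ A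
∈-∩⁻ A U = ∈-filter⁻ (_∈? A)

∈-−⁺ : ∀ A U {l} → l ∈ U → l ∉ A → l ∈ U − A
∈-−⁺ A U = ∈-filter⁺ (λ l → ¬? (l ∈? A))

∈-−⁻ : ∀ A U {l} → l ∈ U − A → l ∈ U × l ∉ A
∈-−⁻ A U = ∈-filter⁻ (λ l → ¬? (l ∈? A))

∩-≐⇔agree : ∀ U A B → (A ∩ U) ≐ (B ∩ U) ⇔ AgreeOn U A B
∩-≐⇔agree U A B = mk⇔ agree-from-∩ (λ A~B → restrict A~B , restrict (agree-sym A~B))
  where
  agree-from-∩ : (A ∩ U) ≐ (B ∩ U) → AgreeOn U A B
  agree-from-∩ (A∩U⊆B∩U , B∩U⊆A∩U) l∈U =
    (λ l∈A → proj₂ (∈-∩⁻ B U (A∩U⊆B∩U (∈-∩⁺ A U l∈U l∈A)))) ,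
    (λ l∈B → proj₂ (∈-∩⁻ A U (B∩U⊆A∩U (∈-∩⁺ B U l∈U l∈B))))
  restrict : ∀ {C D} → AgreeOn U C D → (C ∩ U) ⊆ (D ∩ U)
  restrict {C} {D} C~D l∈C∩U =
    let l∈U , l∈C = ∈-∩⁻ C U l∈C∩U in ∈-∩⁺ D U l∈U (proj₁ (C~D l∈U) l∈C)

agree? : ∀ U A B → Dec (AgreeOn U A B)
agree? U A B =
  Dec.map (∩-≐⇔agree U A B) (((A ∩ U) ⊆? (B ∩ U)) ×-dec ((B ∩ U) ⊆? (A ∩ U)))

agree⇔body : ∀ U X A → AgreeOn U A X ⇔ (All (_∈ A) (X ∩ U) × All (_∉ A) (U − X))
agree⇔body U X A = mk⇔ agree⇒body body⇒agree
  where
  agree⇒body : AgreeOn U A X → All (_∈ A) (X ∩ U) × All (_∉ A) (U − X)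
  agree⇒body A~X =
    All.tabulate (λ l∈X∩U →
      let l∈U , l∈X = ∈-∩⁻ X U l∈X∩U in proj₂ (A~X l∈U) l∈X) ,
    All.tabulate (λ l∈U−X l∈A →
      let l∈U , l∉X = ∈-−⁻ X U l∈U−X in l∉X (proj₁ (A~X l∈U) l∈A))
  body⇒agree : All (_∈ A) (X ∩ U) × All (_∉ A) (U − X) → AgreeOn U A X
  body⇒agree (inside , outside) {l} l∈U with l ∈? X
  ... | yes l∈X = (λ _ → l∈X) , (λ _ → All.lookup inside (∈-∩⁺ X U l∈U l∈X))
  ... | no l∉X =
    (λ l∈A → ⊥-elim (All.lookup outside (∈-−⁺ X U l∈U l∉X) l∈A)) , (λ l∈X → ⊥-elim (l∉X l∈X))

head⊆litR : ∀ r → head r ⊆ litR r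
head⊆litR r = xs⊆xs++ys (head r) _

body⁺⊆litR : ∀ r → body⁺ r ⊆ litR r
body⁺⊆litR r = ∈-++⁺ʳ (head r) ∘ xs⊆xs++ys (body⁺ r) _

body⁻⊆litR : ∀ r → body⁻ r ⊆ litR r
body⁻⊆litR r = ∈-++⁺ʳ (head r) ∘ ∈-++⁺ʳ (body⁺ r)

Satisfies-cong : ∀ r {A B} → AgreeOn (litR r) A B → Satisfies A r → Satisfies B r
Satisfies-cong r A~B A⊨r B⊨b⁺ B⊭b⁻ =
  Any-map-∈ (λ l∈h → proj₁ (A~B (head⊆litR r l∈h)))
    (A⊨r (All-map-∈ (λ l∈b → proj₂ (A~B (body⁺⊆litR r l∈b))) B⊨b⁺)
         (All-map-∈ (λ l∈b l∉B l∈A → l∉B (proj₁ (A~B (body⁻⊆litR r l∈b)) l∈A))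
                    B⊭b⁻))

body⁻-disjoint? : ∀ X r → Dec (All (_∉ X) (body⁻ r))
body⁻-disjoint? X r = all? (λ l → ¬? (l ∈? X)) (body⁻ r)

module Programs {c ℓ} (G : CommutativeMonoid c ℓ) where
  open LPMLN G
  open CommutativeMonoid G using (ε; _∙_) renaming (refl to ≈-refl)
  open ≡-Reasoning

  ∈-lit⁺ : ∀ {M wr l} → wr ∈ M → l ∈ litR (proj₂ wr) → l ∈ litP (bar M)
  ∈-lit⁺ wr∈M l∈r = ∈-concatMap⁺ litR (lose (∈-map⁺ proj₂ wr∈M) l∈r)

  ∈-lit⁻ : ∀ M {l} → l ∈ litP (bar M) → ∃ λ wr → wr ∈ M × l ∈ litR (proj₂ wr)
  ∈-lit⁻ M l∈M with find (∈-concatMap⁻ litR {xs = bar M} l∈M)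
  ... | r , r∈M , l∈r with ∈-map⁻ proj₂ r∈M
  ...   | wr , wr∈M , refl = wr , wr∈M , l∈r

  lit-++ˡ : ∀ M N → litP (bar M) ⊆ litP (bar (M ++ N))
  lit-++ˡ M N = concatMap⁺ litR (map⁺ proj₂ (xs⊆xs++ys M N))

  ≡⇒≋ : ∀ {e f} → e ≡ f → e ≋ f
  ≡⇒≋ refl = lift refl , ≈-refl

  Hard : WRule → Set c
  Hard wr = proj₁ wr ≡ α

  Wprog-hard : ∀ {N} → All Hard N → Wprog N ≡ length N α+ ε
  Wprog-hard [] = refl
  Wprog-hard (refl ∷ hard) = cong (λ e → suc (nα e) α+ sr e) (Wprog-hard hard)

  Wprog-++-hard : ∀ M {N} → All Hard N → Wprog (M ++ N) ≡ Wprog M ·eα^ length N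
  Wprog-++-hard [] hard = Wprog-hard hard
  Wprog-++-hard ((α , _) ∷ M) hard =
    cong (λ e → suc (nα e) α+ sr e) (Wprog-++-hard M hard)
  Wprog-++-hard ((real w , _) ∷ M) hard =
    cong (λ e → nα e α+ (w ∙ sr e)) (Wprog-++-hard M hard)

  satisfiesʷ? : ∀ Y (wr : WRule) → Dec (Satisfies Y (proj₂ wr))
  satisfiesʷ? Y wr = satisfies? Y (proj₂ wr)

  W-cong : ∀ M {A B} → AgreeOn (litP (bar M)) A B → W M A ≡ W M B
  W-cong M {A} {B} A~B = cong Wprog (filter-cong-∈ (satisfiesʷ? A) (satisfiesʷ? B) M
    λ {wr} wr∈M → Satisfies-cong (proj₂ wr) (agree-mono (∈-lit⁺ wr∈M) A~B) ,
                  Satisfies-cong (proj₂ wr) (agree-mono (∈-lit⁺ wr∈M) (agree-sym A~B)))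

  -- Y satisfies the reduct (M̄_X)^X.
  ReductModel : Program → LitSet → LitSet → Set c
  ReductModel M X Y = ∀ {wr} → wr ∈ M → let r = proj₂ wr in
    Satisfies X r → All (_∉ X) (body⁻ r) → All (_∈ Y) (body⁺ r) → Any (_∈ Y) (head r)

  ReductModel-refl : ∀ M X → ReductModel M X X
  ReductModel-refl _ _ _ X⊨r X⊭b⁻ X⊨b⁺ = X⊨r X⊨b⁺ X⊭b⁻

  ReductModel⇒Satisfies : ∀ M X Y → ReductModel M X Y →
                          SatisfiesP Y (reduct (bar (sat M X)) X)
  ReductModel⇒Satisfies M X Y Y⊨ = All.tabulate reduced
    where
    reduced : ∀ {r} → r ∈ reduct (bar (sat M X)) X → Satisfies Y r
    reduced r∈ with ∈-map⁻ _ r∈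
    ... | r , r∈kept , refl with ∈-filter⁻ (body⁻-disjoint? X) r∈kept
    ...   | r∈bar , X⊭b⁻ with ∈-map⁻ proj₂ r∈bar
    ...     | wr , wr∈sat , refl with ∈-filter⁻ (satisfiesʷ? X) wr∈sat
    ...       | wr∈M , X⊨r = λ Y⊨b⁺ _ → Y⊨ wr∈M X⊨r X⊭b⁻ Y⊨b⁺

  Satisfies⇒ReductModel : ∀ M X Y → SatisfiesP Y (reduct (bar (sat M X)) X) →
                          ReductModel M X Y
  Satisfies⇒ReductModel M X Y Y⊨ wr∈M X⊨r X⊭b⁻ Y⊨b⁺ =
    All.lookup Y⊨ (∈-map⁺ _ (∈-filter⁺ (body⁻-disjoint? X)
                    (∈-map⁺ proj₂ (∈-filter⁺ (satisfiesʷ? X) wr∈M X⊨r)) X⊭b⁻))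
                  Y⊨b⁺ []

  ReductModel-++⁺ : ∀ {M N X Y} → ReductModel M X Y → ReductModel N X Y →
                    ReductModel (M ++ N) X Y
  ReductModel-++⁺ {M} M⊨ N⊨ wr∈M++N with ∈-++⁻ M wr∈M++N
  ... | inj₁ wr∈M = M⊨ wr∈M
  ... | inj₂ wr∈N = N⊨ wr∈N

  ReductModel-++⁻ˡ : ∀ {M N X Y} → ReductModel (M ++ N) X Y → ReductModel M X Y
  ReductModel-++⁻ˡ {M} {N} M++N⊨ = M++N⊨ ∘ xs⊆xs++ys M N

  ReductModel-++⁻ʳ : ∀ {M N X Y} → ReductModel (M ++ N) X Y → ReductModel N X Y
  ReductModel-++⁻ʳ {M} M++N⊨ = M++N⊨ ∘ ∈-++⁺ʳ M

  ReductModel-cong : ∀ M {A A′ B B′} →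
                     AgreeOn (litP (bar M)) A A′ → AgreeOn (litP (bar M)) B B′ →
                     ReductModel M A B → ReductModel M A′ B′
  ReductModel-cong M A~A′ B~B′ B⊨ {wr} wr∈M A′⊨r A′⊭b⁻ B′⊨b⁺ =
    Any-map-∈ (λ l∈h → proj₁ (B~B′ (on-lit (head⊆litR r l∈h))))
      (B⊨ wr∈M (Satisfies-cong r (agree-sym (agree-mono on-lit A~A′)) A′⊨r)
               (All-map-∈ (λ l∈b l∉A′ → l∉A′ ∘ proj₁ (A~A′ (on-lit (body⁻⊆litR r l∈b))))
                          A′⊭b⁻)
               (All-map-∈ (λ l∈b → proj₂ (B~B′ (on-lit (body⁺⊆litR r l∈b)))) B′⊨b⁺))
    where
    r = proj₂ wr
    on-lit : litR r ⊆ litP (bar M)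
    on-lit = ∈-lit⁺ wr∈M

  IsStable : Program → LitSet → Set c
  IsStable M X = Consistent X × (∀ Y → Y ⊆ X → ReductModel M X Y → X ⊆ Y)

  SM⇒IsStable : ∀ {M X} → SM M X → IsStable M X
  SM⇒IsStable {M} {X} (consistent , _ , minimal) =
    consistent , λ Y Y⊆X Y⊨ →
      decidable-stable (X ⊆? Y) λ X⊈Y →
        minimal Y Y⊆X X⊈Y (ReductModel⇒Satisfies M X Y Y⊨)

  IsStable⇒SM : ∀ {M X} → IsStable M X → SM M X
  IsStable⇒SM {M} {X} (consistent , minimal) =
    consistent , ReductModel⇒Satisfies M X X (ReductModel-refl M X) ,
    λ Y Y⊆X X⊈Y Y⊨ → X⊈Y (minimal Y Y⊆X (Satisfies⇒ReductModel M X Y Y⊨))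

  IsStable-resp-≐ : ∀ M {X Y} → X ≐ Y → IsStable M X → IsStable M Y
  IsStable-resp-≐ M (X⊆Y , Y⊆X) (consistent , minimal) =
    (λ b pos-b neg-b → consistent b (Y⊆X pos-b) (Y⊆X neg-b)) ,
    λ Y′ Y′⊆Y Y′⊨ → ⊆-trans Y⊆X (minimal Y′ (⊆-trans Y′⊆Y Y⊆X)
                                   (ReductModel-cong M (≐⇒agree (Y⊆X , X⊆Y)) agree-refl Y′⊨))

  -- X ∩ lit(M) is a model of the reduct, so minimality forces X ⊆ lit(M).
  IsStable⇒⊆lit : ∀ M {X} → IsStable M X → X ⊆ litP (bar M)
  IsStable⇒⊆lit M {X} (_ , minimal) l∈X =
    proj₂ (∈-∩⁻ L X (minimal (L ∩ X) (proj₁ ∘ ∈-∩⁻ L X) X∩L⊨ l∈X))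
    where
    L = litP (bar M)
    X∩L⊨ : ReductModel M X (L ∩ X)
    X∩L⊨ {wr} wr∈M X⊨r X⊭b⁻ X∩L⊨b⁺ =
      Any-map-∈ (λ l∈h l∈X → ∈-∩⁺ L X l∈X (∈-lit⁺ wr∈M (head⊆litR (proj₂ wr) l∈h)))
        (X⊨r (All-map-∈ (λ _ → proj₁ ∘ ∈-∩⁻ L X) X∩L⊨b⁺) X⊭b⁻)

  fact : Literal → WRule
  fact b = α , rule (b ∷ []) [] []

  fact∈T0 : ∀ M {U b} → b ∈ U → fact b ∈ T0 M U
  fact∈T0 M b∈U = ∈-++⁺ʳ M (∈-map⁺ fact b∈U)

  lit-T0⊆ : ∀ M U → litP (bar M) ⊆ U → litP (bar (T0 M U)) ⊆ U
  lit-T0⊆ M U litM⊆U l∈T0 with ∈-lit⁻ (T0 M U) l∈T0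
  ... | wr , wr∈T0 , l∈r with ∈-++⁻ M wr∈T0
  ...   | inj₁ wr∈M = litM⊆U (∈-lit⁺ wr∈M l∈r)
  ...   | inj₂ wr∈facts with ∈-map⁻ fact wr∈facts
  ...     | b , b∈U , refl = subst (_∈ U) (sym (singleton⁻ l∈r)) b∈U

  U⊆lit-FlatExt : ∀ {M U T} → FlatExt M U T → U ⊆ litP (bar T)
  U⊆lit-FlatExt {M} base b∈U = ∈-lit⁺ (fact∈T0 M b∈U) (here refl)
  U⊆lit-FlatExt {U = U} (step {T} X a ext _ _) =
    lit-++ˡ T (Rprog (X ∩ U) (U − X) a) ∘ U⊆lit-FlatExt ext

  FreshAtom⇒∉U : ∀ {M U T a} → FlatExt M U T → FreshAtom a T → pos a ∉ U
  FreshAtom⇒∉U ext fresh = proj₁ fresh ∘ U⊆lit-FlatExt ext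

  IsStable-T0⇔ : ∀ M U {Y} → litP (bar M) ⊆ U →
                 IsStable (T0 M U) Y ⇔ (Consistent Y × Y ⊆ U)
  IsStable-T0⇔ M U {Y} litM⊆U = mk⇔
    (λ stable → proj₁ stable ,
                λ {_} l∈Y → lit-T0⊆ M U litM⊆U (IsStable⇒⊆lit (T0 M U) stable l∈Y))
    (λ (consistent , Y⊆U) → consistent , λ Y′ _ Y′⊨ l∈Y →
      singleton⁻ (Y′⊨ (fact∈T0 M (Y⊆U l∈Y)) (λ _ _ → here l∈Y) [] []))

  SM-T0⇔ : ∀ M U {Y} → litP (bar M) ⊆ U → SM (T0 M U) Y ⇔ (Consistent Y × Y ⊆ U)
  SM-T0⇔ M U litM⊆U = mk⇔ (to (IsStable-T0⇔ M U litM⊆U) ∘ SM⇒IsStable)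
                           (IsStable⇒SM ∘ from (IsStable-T0⇔ M U litM⊆U))

  StableWeightsAgreeOn : LitSet → Program → Set c
  StableWeightsAgreeOn U T =
    ∀ {Y Z} → IsStable T Y → IsStable T Z → AgreeOn U Y Z → W T Y ≡ W T Z

  module Flattening (T : Program) (U X : LitSet) (a : Atom) where

    Rₐ : Program
    Rₐ = Rprog (X ∩ U) (U − X) a

    T′ : Program
    T′ = extend U T X a

    r⊥ rₐ : Rule
    r⊥ = rule [] ((X ∩ U) ++ pos a ∷ []) (U − X)
    rₐ = rule (pos a ∷ []) (X ∩ U) (U − X)

    body⇒agree : ∀ {A} → All (_∈ A) (X ∩ U) → All (_∉ A) (U − X) → AgreeOn U A X
    body⇒agree inside outside = from (agree⇔body U X _) (inside , outside)

    agree⇒body⁺ : ∀ {A} → AgreeOn U A X → All (_∈ A) (X ∩ U)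
    agree⇒body⁺ = proj₁ ∘ to (agree⇔body U X _)

    agree⇒body⁻ : ∀ {A} → AgreeOn U A X → All (_∉ A) (U − X)
    agree⇒body⁻ = proj₂ ∘ to (agree⇔body U X _)

    r⊥-satisfied : ∀ {A} → ¬ (AgreeOn U A X × pos a ∈ A) → Satisfies A r⊥
    r⊥-satisfied {A} ¬fired A⊨b⁺ A⊭b⁻ =
      let inside , a∈A = ++⁻ (X ∩ U) A⊨b⁺
      in ⊥-elim (¬fired (body⇒agree inside A⊭b⁻ , All.head a∈A))

    r⊥-violated : ∀ {A} → AgreeOn U A X → pos a ∈ A → ¬ Satisfies A r⊥
    r⊥-violated A~X a∈A A⊨r⊥
      with () ← A⊨r⊥ (++⁺ (agree⇒body⁺ A~X) (a∈A ∷ [])) (agree⇒body⁻ A~X)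

    rₐ-satisfied : ∀ {A} → (AgreeOn U A X → pos a ∈ A) → Satisfies A rₐ
    rₐ-satisfied supported A⊨b⁺ A⊭b⁻ = here (supported (body⇒agree A⊨b⁺ A⊭b⁻))

    rₐ-violated : ∀ {A} → AgreeOn U A X → pos a ∉ A → ¬ Satisfies A rₐ
    rₐ-violated A~X a∉A A⊨rₐ =
      a∉A (singleton⁻ (A⊨rₐ (agree⇒body⁺ A~X) (agree⇒body⁻ A~X)))

    Rₐ-hard : All Hard Rₐ
    Rₐ-hard = refl ∷ refl ∷ []

    W-extend : ∀ Y → W T′ Y ≡ W T Y ·eα^ length (sat Rₐ Y)
    W-extend Y = begin
      Wprog (sat (T ++ Rₐ) Y)      ≡⟨ cong Wprog (filter-++ (satisfiesʷ? Y) T Rₐ) ⟩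
      Wprog (sat T Y ++ sat Rₐ Y)  ≡⟨ Wprog-++-hard (sat T Y) (filter⁺ (satisfiesʷ? Y) Rₐ-hard) ⟩
      W T Y ·eα^ length (sat Rₐ Y) ∎

    length-sat-Rₐ-agree : ∀ {Y} → AgreeOn U Y X → length (sat Rₐ Y) ≡ 1
    length-sat-Rₐ-agree {Y} Y~X with pos a ∈? Y
    ... | yes a∈Y = cong length (trans (filter-reject Y⊨? (r⊥-violated Y~X a∈Y))
                                       (filter-accept Y⊨? (rₐ-satisfied (λ _ → a∈Y))))
      where Y⊨? = satisfiesʷ? Y
    ... | no a∉Y = cong length (trans (filter-accept Y⊨? (r⊥-satisfied (a∉Y ∘ proj₂)))
                                      (cong (_ ∷_) (filter-reject Y⊨? (rₐ-violated Y~X a∉Y))))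
      where Y⊨? = satisfiesʷ? Y

    length-sat-Rₐ-disagree : ∀ {Y} → ¬ AgreeOn U Y X → length (sat Rₐ Y) ≡ 2
    length-sat-Rₐ-disagree {Y} ¬Y~X =
      cong length (trans (filter-accept Y⊨? (r⊥-satisfied (¬Y~X ∘ proj₁)))
                         (cong (_ ∷_) (filter-accept Y⊨? (rₐ-satisfied (⊥-elim ∘ ¬Y~X)))))
      where Y⊨? = satisfiesʷ? Y

    W-extend-agree : ∀ {Y} → AgreeOn U Y X → W T′ Y ≡ W T Y ·eα^ 1
    W-extend-agree {Y} Y~X =
      trans (W-extend Y) (cong (W T Y ·eα^_) (length-sat-Rₐ-agree Y~X))

    W-extend-disagree : ∀ {Y} → ¬ AgreeOn U Y X → W T′ Y ≡ W T Y ·eα^ 2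
    W-extend-disagree {Y} ¬Y~X =
      trans (W-extend Y) (cong (W T Y ·eα^_) (length-sat-Rₐ-disagree ¬Y~X))

    ReductModel-Rₐ-⊆ : ∀ {A B} → B ⊆ A → ¬ (AgreeOn U A X × pos a ∈ A) →
                       ReductModel Rₐ A B
    ReductModel-Rₐ-⊆ B⊆A ¬fired (here refl) _ A⊭b⁻ B⊨b⁺ =
      let inside , a∈B = ++⁻ (X ∩ U) B⊨b⁺
      in ⊥-elim (¬fired (body⇒agree (All.map B⊆A inside) A⊭b⁻ , B⊆A (All.head a∈B)))
    ReductModel-Rₐ-⊆ B⊆A ¬fired (there (here refl)) A⊨rₐ A⊭b⁻ B⊨b⁺ =
      let A⊨b⁺ = All.map B⊆A B⊨b⁺
      in ⊥-elim (¬fired (body⇒agree A⊨b⁺ A⊭b⁻ , singleton⁻ (A⊨rₐ A⊨b⁺ A⊭b⁻)))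

    ReductModel-Rₐ-∋ : ∀ {A B} → pos a ∈ B → AgreeOn U A X → pos a ∈ A →
                       ReductModel Rₐ A B
    ReductModel-Rₐ-∋ _ A~X a∈A (here refl) A⊨r⊥ = ⊥-elim (r⊥-violated A~X a∈A A⊨r⊥)
    ReductModel-Rₐ-∋ a∈B _ _ (there (here refl)) _ _ _ = here a∈B

    ReductModel-Rₐ⇒∈ : ∀ {A B} → ReductModel Rₐ A B → pos a ∈ A → AgreeOn U A X →
                       All (_∈ B) (X ∩ U) → pos a ∈ B
    ReductModel-Rₐ⇒∈ B⊨ a∈A A~X B⊨b⁺ =
      singleton⁻ (B⊨ (there (here refl)) (λ _ _ → here a∈A) (agree⇒body⁻ A~X) B⊨b⁺)

    IsStable-extend⁺ : ∀ {Y} → IsStable T Y → IsStable T′ Y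
    IsStable-extend⁺ (consistent , minimal) =
      consistent , λ Y′ Y′⊆Y Y′⊨ → minimal Y′ Y′⊆Y (ReductModel-++⁻ˡ Y′⊨)

    module Fresh (fresh : FreshAtom a T) (a∉U : pos a ∉ U) where

      a∉litT : pos a ∉ litP (bar T)
      a∉litT = proj₁ fresh

      OldOrNew : LitSet → Set c
      OldOrNew Y = IsStable T Y ⊎ ∃ λ Z → IsStable T Z × AgreeOn U Z X × Y ≐ (pos a ∷ Z)

      IsStable-extend-∌ : ∀ {Y} → IsStable T′ Y → pos a ∉ Y → IsStable T Y
      IsStable-extend-∌ (consistent , minimal) a∉Y =
        consistent , λ Y′ Y′⊆Y Y′⊨ →
          minimal Y′ Y′⊆Y (ReductModel-++⁺ Y′⊨ (ReductModel-Rₐ-⊆ Y′⊆Y (a∉Y ∘ proj₂)))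

      -- Otherwise Y without a would be a smaller model of the reduct: only rₐ can support a.
      IsStable-extend-∋⇒agree : ∀ {Y} → IsStable T′ Y → pos a ∈ Y → AgreeOn U Y X
      IsStable-extend-∋⇒agree {Y} (_ , minimal) a∈Y =
        decidable-stable (agree? U Y X) λ ¬Y~X →
          proj₂ (∈-delete⁻ Y (minimal (delete (pos a) Y) delete-⊆ (smaller ¬Y~X) a∈Y)) refl
        where
        smaller : ¬ AgreeOn U Y X → ReductModel T′ Y (delete (pos a) Y)
        smaller ¬Y~X = ReductModel-++⁺
          (ReductModel-cong T agree-refl (agree-delete a∉litT) (ReductModel-refl T Y))
          (ReductModel-Rₐ-⊆ delete-⊆ (¬Y~X ∘ proj₁))

      IsStable-extend-∋ : ∀ {Y} → IsStable T′ Y → pos a ∈ Y → IsStable T (delete (pos a) Y)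
      IsStable-extend-∋ {Y} stable@(consistent , minimal) a∈Y =
        (λ b pos-b neg-b → consistent b (delete-⊆ pos-b) (delete-⊆ neg-b)) ,
        λ Z′ Z′⊆Y-a Z′⊨ →
          delete-⊆-∷ (minimal (pos a ∷ Z′) (∈-∷⁺ʳ a∈Y (⊆-trans Z′⊆Y-a delete-⊆))
            (ReductModel-++⁺
              (ReductModel-cong T (agree-sym (agree-delete a∉litT)) (agree-sym (agree-∷ a∉litT))
                                  Z′⊨)
              (ReductModel-Rₐ-∋ (here refl) (IsStable-extend-∋⇒agree stable a∈Y) a∈Y)))

      IsStable-extend-∷ : ∀ {Z} → IsStable T Z → AgreeOn U Z X → IsStable T′ (pos a ∷ Z)
      IsStable-extend-∷ {Z} stable@(consistent , minimal) Z~X = consistent′ , minimal′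
        where
        a∷Z~X : AgreeOn U (pos a ∷ Z) X
        a∷Z~X = agree-trans (agree-∷ a∉U) Z~X
        consistent′ : Consistent (pos a ∷ Z)
        consistent′ _ _ (here ())
        consistent′ _ (here refl) (there neg-a) = proj₂ fresh (IsStable⇒⊆lit T stable neg-a)
        consistent′ b (there pos-b) (there neg-b) = consistent b pos-b neg-b
        minimal′ : ∀ Y′ → Y′ ⊆ (pos a ∷ Z) → ReductModel T′ (pos a ∷ Z) Y′ →
                   (pos a ∷ Z) ⊆ Y′
        minimal′ Y′ Y′⊆a∷Z Y′⊨ = ∈-∷⁺ʳ a∈Y′ Z⊆Y′
          where
          Z⊆Y′ : Z ⊆ Y′
          Z⊆Y′ = ⊆-trans (minimal (delete (pos a) Y′) (delete-⊆-∷ Y′⊆a∷Z)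
                            (ReductModel-cong T (agree-∷ a∉litT) (agree-delete a∉litT)
                               (ReductModel-++⁻ˡ Y′⊨)))
                         delete-⊆
          a∈Y′ : pos a ∈ Y′
          a∈Y′ = ReductModel-Rₐ⇒∈ (ReductModel-++⁻ʳ Y′⊨) (here refl) a∷Z~X
                   (All.map Z⊆Y′ (agree⇒body⁺ Z~X))

      IsStable-extend⇔ : ∀ Y → IsStable T′ Y ⇔ OldOrNew Y
      IsStable-extend⇔ Y = mk⇔ split join
        where
        split : IsStable T′ Y → OldOrNew Y
        split stable with pos a ∈? Y
        ... | no a∉Y = inj₁ (IsStable-extend-∌ stable a∉Y)
        ... | yes a∈Y = inj₂ (delete (pos a) Y , IsStable-extend-∋ stable a∈Y ,
                              agree-trans (agree-sym (agree-delete a∉U))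
                                          (IsStable-extend-∋⇒agree stable a∈Y) ,
                              ∷-delete-≐ a∈Y)
        join : OldOrNew Y → IsStable T′ Y
        join (inj₁ stable) = IsStable-extend⁺ stable
        join (inj₂ (Z , stable , Z~X , Y≐a∷Z)) =
          IsStable-resp-≐ T′ (≐-sym Y≐a∷Z) (IsStable-extend-∷ stable Z~X)

      IsStable-extend⇒restriction : ∀ {Y} → IsStable T′ Y →
        ∃ λ Y₀ → IsStable T Y₀ × AgreeOn (litP (bar T)) Y Y₀ × AgreeOn U Y Y₀
      IsStable-extend⇒restriction {Y} stable with to (IsStable-extend⇔ Y) stable
      ... | inj₁ stable₀ = Y , stable₀ , agree-refl , agree-refl
      ... | inj₂ (Z , stable₀ , _ , Y≐a∷Z) =
        Z , stable₀ , agree-≐∷ a∉litT Y≐a∷Z , agree-≐∷ a∉U Y≐a∷Z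

      W-restriction-agree : StableWeightsAgreeOn U T →
                            ∀ {Y Z} → IsStable T′ Y → IsStable T′ Z → AgreeOn U Y Z →
                            W T Y ≡ W T Z
      W-restriction-agree weights-agree {Y} {Z} stable-Y stable-Z Y~Z
        with IsStable-extend⇒restriction stable-Y | IsStable-extend⇒restriction stable-Z
      ... | Y₀ , stable-Y₀ , Y~Y₀ , Y~ᵤY₀ | Z₀ , stable-Z₀ , Z~Z₀ , Z~ᵤZ₀ = begin
        W T Y   ≡⟨ W-cong T Y~Y₀ ⟩
        W T Y₀  ≡⟨ weights-agree stable-Y₀ stable-Z₀ Y₀~ᵤZ₀ ⟩
        W T Z₀  ≡⟨ W-cong T (agree-sym Z~Z₀) ⟩
        W T Z   ∎
        where
        Y₀~ᵤZ₀ : AgreeOn U Y₀ Z₀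
        Y₀~ᵤZ₀ = agree-trans (agree-sym Y~ᵤY₀) (agree-trans Y~Z Z~ᵤZ₀)

      StableWeightsAgreeOn-extend : StableWeightsAgreeOn U T → StableWeightsAgreeOn U T′
      StableWeightsAgreeOn-extend weights-agree {Y} {Z} stable-Y stable-Z Y~Z
        with W-restriction-agree weights-agree stable-Y stable-Z Y~Z | agree? U Y X
      ... | WTY≡WTZ | yes Y~X = begin
        W T′ Y        ≡⟨ W-extend-agree Y~X ⟩
        W T Y ·eα^ 1  ≡⟨ cong (_·eα^ 1) WTY≡WTZ ⟩
        W T Z ·eα^ 1  ≡⟨ W-extend-agree (agree-trans (agree-sym Y~Z) Y~X) ⟨
        W T′ Z        ∎
      ... | WTY≡WTZ | no ¬Y~X = begin
        W T′ Y        ≡⟨ W-extend-disagree ¬Y~X ⟩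
        W T Y ·eα^ 2  ≡⟨ cong (_·eα^ 2) WTY≡WTZ ⟩
        W T Z ·eα^ 2  ≡⟨ W-extend-disagree (¬Y~X ∘ agree-trans Y~Z) ⟨
        W T′ Z        ∎

      SM-OldOrNew : LitSet → Set
      SM-OldOrNew Y = SM T Y ⊎ ∃ λ Z → SM T Z × (Z ∩ U) ≐ (X ∩ U) × Y ≐ (pos a ∷ Z)

      SM-extend⇔ : ∀ Y → SM T′ Y ⇔ SM-OldOrNew Y
      SM-extend⇔ Y = mk⇔ split join
        where
        split : SM T′ Y → SM-OldOrNew Y
        split sm with to (IsStable-extend⇔ Y) (SM⇒IsStable sm)
        ... | inj₁ stable = inj₁ (IsStable⇒SM stable)
        ... | inj₂ (Z , stable , Z~X , Y≐a∷Z) =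
          inj₂ (Z , IsStable⇒SM stable , from (∩-≐⇔agree U Z X) Z~X , Y≐a∷Z)
        join : SM-OldOrNew Y → SM T′ Y
        join (inj₁ sm) = IsStable⇒SM (from (IsStable-extend⇔ Y) (inj₁ (SM⇒IsStable sm)))
        join (inj₂ (Z , sm , Z∩U≐X∩U , Y≐a∷Z)) = IsStable⇒SM (from (IsStable-extend⇔ Y)
          (inj₂ (Z , SM⇒IsStable sm , to (∩-≐⇔agree U Z X) Z∩U≐X∩U , Y≐a∷Z)))

  StableWeightsAgreeOn-FlatExt : ∀ {M U T} → litP (bar M) ⊆ U → FlatExt M U T →
                                 StableWeightsAgreeOn U T
  StableWeightsAgreeOn-FlatExt {M} {U} litM⊆U base _ _ Y~Z =
    W-cong (T0 M U) (agree-mono (lit-T0⊆ M U litM⊆U) Y~Z)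
  StableWeightsAgreeOn-FlatExt {U = U} litM⊆U (step {T} X a ext _ fresh) =
    Flattening.Fresh.StableWeightsAgreeOn-extend T U X a fresh (FreshAtom⇒∉U ext fresh)
      (StableWeightsAgreeOn-FlatExt litM⊆U ext)

proposition3 : ∀ {c ℓ} (G : CommutativeMonoid c ℓ) → let open LPMLN G in
    (M : Program) (U : LitSet) → litP (bar M) ⊆ U →
    (T : Program) → FlatExt M U T →
    (X : LitSet) → PSM T X → (a : Atom) → FreshAtom a T →
    ((∀ Y → SM (T0 M U) Y ⇔ (Consistent Y × Y ⊆ U))
    × (∀ Y → SM (extend U T X a) Y ⇔
         (SM T Y ⊎ ∃ (λ Z → SM T Z × (Z ∩ U) ≐ (X ∩ U) × Y ≐ (pos a ∷ Z))))
    × (∀ Y → SM T Y →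
         (¬ ((Y ∩ U) ≐ (X ∩ U)) → W (extend U T X a) Y ≋ (W T Y ·eα^ 2))
         × ((Y ∩ U) ≐ (X ∩ U) → W (extend U T X a) Y ≋ (W T Y ·eα^ 1)))
    × (∀ Y Z → SM T Y → SM T Z → (Y ∩ U) ≐ (Z ∩ U) → W T Y ≋ W T Z))
proposition3 G M U litM⊆U T ext X _ a fresh =
  (λ _ → SM-T0⇔ M U litM⊆U) ,
  SM-extend⇔ ,
  (λ Y _ → (λ Y∩U≭X∩U → ≡⇒≋ (W-extend-disagree (Y∩U≭X∩U ∘ from (∩-≐⇔agree U Y X)))) ,
           (λ Y∩U≐X∩U → ≡⇒≋ (W-extend-agree (to (∩-≐⇔agree U Y X) Y∩U≐X∩U)))) ,
  (λ Y Z sm-Y sm-Z Y∩U≐Z∩U → ≡⇒≋ (StableWeightsAgreeOn-FlatExt litM⊆U ext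
      (SM⇒IsStable sm-Y) (SM⇒IsStable sm-Z) (to (∩-≐⇔agree U Y Z) Y∩U≐Z∩U)))
  where
  open Programs G
  open Flattening T U X a
  open Fresh fresh (FreshAtom⇒∉U ext fresh)
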